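{- For every finite directed acyclic graph $G$ with a distinguished node \texttt{Start} and a distinguished node \texttt{End}, the procedure \textsc{SimplifyDAG}$(G)$ terminates.
   Context: In $G$, nodes other than \texttt{Start} and \texttt{End} are internal; $\text{Parents}(u)$ and $\text{Children}(u)$ denote the sets of in- and out-neighbours of $u$. Operations: \textsc{MergeNodes}$(u,v)$ creates a new node $w$, adds an edge $p\to w$ for every $p\in\text{Parents}(u)$ and an edge $w\to c$ for every $c\in\text{Children}(v)$, and removes $u$ and $v$ (with their incident edges). \textsc{TryExtend}: if there is an edge $(u,v)$ with $u\ne v$, $u\ne\texttt{Start}$, $v\ne\texttt{End}$, $\text{Children}(u)=\{v\}$ and $\text{Parents}(v)=\{u\}$, perform \textsc{MergeNodes}$(u,v)$ and return true; else return false. \textsc{TryJoin}: if there are distinct internal nodes $u,v$ with $\text{Parents}(u)=\text{Parents}(v)$ and $\text{Children}(u)=\text{Children}(v)$, perform \textsc{MergeNodes}$(u,v)$ and return true; else return false. \textsc{TrySplit}: if there is an internal node $u$ with $|\text{Children}(u)|>1$, replace it by two new nodes $u_1,u_2$, each receiving an edge from every node of $\text{Parents}(u)$, partition $\text{Children}(u)$ into $C_1,C_2$ with $|C_1|=1$, add edges $u_1\to c$ for $c\in C_1$ and $u_2\to c$ for $c\in C_2$, remove $u$, and return true; else return false. \textsc{SimplifyDAG}$(G)$: while $G$ has more than 3 nodes, apply \textsc{TryExtend}; if it returned true continue the loop; otherwise apply \textsc{TryJoin}; if true continue; otherwise apply \textsc{TrySplit}; if true continue; otherwise exit the loop. -}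

module Defs where

open import Data.Nat using (ℕ; _<_)
open import Data.Fin using (Fin; _≟_)
open import Data.Bool using (Bool; true; false; T; _∧_; not)
open import Data.Unit using (⊤; tt)
open import Data.Sum using (_⊎_; inj₁; inj₂)
open import Data.Product using (Σ; _×_; proj₁; ∃)
open import Relation.Nullary using (¬_; does)
open import Relation.Binary.PropositionalEquality using (_≡_; _≢_)
open import Function.Bundles using (_↔_; Inverse)
open import Induction.WellFounded using (Acc)

data Label : Set where
  start end internal : Label

record Graph : Set where
  field
    size  : ℕ
    edge  : Fin size → Fin size → Bool
    label : Fin size → Label
open Graph public

Edge : (G : Graph) → Fin (size G) → Fin (size G) → Set
Edge G x y = edge G x y ≡ true

Internal : (G : Graph) → Fin (size G) → Set
Internal G x = label G x ≡ internal

Kept₂ : (G : Graph) → Fin (size G) → Fin (size G) → Set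
Kept₂ G u v = Σ (Fin (size G)) λ x → x ≢ u × x ≢ v

Kept₁ : (G : Graph) → Fin (size G) → Set
Kept₁ G u = Σ (Fin (size G)) λ x → x ≢ u

-- H is (up to renaming of nodes) the result of MergeNodes(u,v) on G:
-- nodes of H = (nodes of G except u, v) plus one new node w;
-- old edges/labels among kept nodes unchanged; p → w iff p ∈ Parents(u);
-- w → c iff c ∈ Children(v); no loop at w; w is internal.
record MergeResult (G : Graph) (u v : Fin (size G)) (H : Graph) : Set where
  field
    iso : (Kept₂ G u v ⊎ ⊤) ↔ Fin (size H)
  emb : Kept₂ G u v → Fin (size H)
  emb a = Inverse.to iso (inj₁ a)
  w : Fin (size H)
  w = Inverse.to iso (inj₂ tt)
  field
    edge-old : ∀ a b → edge H (emb a) (emb b) ≡ edge G (proj₁ a) (proj₁ b)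
    edge-in  : ∀ a → edge H (emb a) w ≡ edge G (proj₁ a) u
    edge-out : ∀ a → edge H w (emb a) ≡ edge G v (proj₁ a)
    edge-ww  : edge H w w ≡ false
    label-old : ∀ a → label H (emb a) ≡ label G (proj₁ a)
    label-w   : label H w ≡ internal

-- H is (up to renaming) the result of splitting u in G with C₁ = {c₁}:
-- u is replaced by u₁ = new false, u₂ = new true, both receiving edges
-- from every parent of u; u₁ → c₁ only; u₂ → Children(u) ∖ {c₁}.
record SplitResult (G : Graph) (u : Fin (size G)) (c₁ : Kept₁ G u) (H : Graph) : Set where
  field
    iso : (Kept₁ G u ⊎ Bool) ↔ Fin (size H)
  emb : Kept₁ G u → Fin (size H)
  emb a = Inverse.to iso (inj₁ a)
  new : Bool → Fin (size H)
  new b = Inverse.to iso (inj₂ b)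
  field
    edge-old : ∀ a b → edge H (emb a) (emb b) ≡ edge G (proj₁ a) (proj₁ b)
    edge-in  : ∀ a i → edge H (emb a) (new i) ≡ edge G (proj₁ a) u
    edge-out₁ : ∀ a → edge H (new false) (emb a) ≡ does (proj₁ a ≟ proj₁ c₁)
    edge-out₂ : ∀ a → edge H (new true) (emb a)
                  ≡ (edge G u (proj₁ a) ∧ not (does (proj₁ a ≟ proj₁ c₁)))
    edge-new  : ∀ i j → edge H (new i) (new j) ≡ false
    label-old : ∀ a → label H (emb a) ≡ label G (proj₁ a)
    label-new : ∀ i → label H (new i) ≡ internal

ExtendCond : (G : Graph) → Fin (size G) → Fin (size G) → Set
ExtendCond G u v =
  Edge G u v × u ≢ v × label G u ≢ start × label G v ≢ end ×
  (∀ c → Edge G u c → c ≡ v) × (∀ p → Edge G p v → p ≡ u)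

JoinCond : (G : Graph) → Fin (size G) → Fin (size G) → Set
JoinCond G u v =
  u ≢ v × Internal G u × Internal G v ×
  (∀ p → edge G p u ≡ edge G p v) × (∀ c → edge G u c ≡ edge G v c)

SplitCond : (G : Graph) → Fin (size G) → Set
SplitCond G u = Internal G u ×
  Σ (Fin (size G)) λ c → Σ (Fin (size G)) λ c' → c ≢ c' × Edge G u c × Edge G u c'

CanExtend CanJoin CanSplit : Graph → Set
CanExtend G = Σ (Fin (size G)) λ u → Σ (Fin (size G)) λ v → ExtendCond G u v
CanJoin   G = Σ (Fin (size G)) λ u → Σ (Fin (size G)) λ v → JoinCond G u v
CanSplit  G = Σ (Fin (size G)) λ u → SplitCond G u

-- One iteration of the while loop of SimplifyDAG (any admissible choice
-- of witnesses), respecting the priority Extend > Join > Split.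
data Step (G : Graph) (H : Graph) : Set where
  extend : 3 < size G → (u v : Fin (size G)) → ExtendCond G u v →
           MergeResult G u v H → Step G H
  join   : 3 < size G → ¬ CanExtend G → (u v : Fin (size G)) → JoinCond G u v →
           MergeResult G u v H → Step G H
  split  : 3 < size G → ¬ CanExtend G → ¬ CanJoin G → (u : Fin (size G)) →
           SplitCond G u → (c₁ : Kept₁ G u) → Edge G u (proj₁ c₁) →
           SplitResult G u c₁ H → Step G H

-- SimplifyDAG(G) terminates: every run (for every choice of witnesses) is finite.
Terminates : Graph → Set
Terminates G = Acc (λ H G' → Step G' H) G

data Path {n : ℕ} (E : Fin n → Fin n → Bool) : Fin n → Fin n → Set where
  one  : ∀ {x y} → E x y ≡ true → Path E x y
  more : ∀ {x y z} → E x y ≡ true → Path E y z → Path E x z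

Acyclic : {n : ℕ} → (Fin n → Fin n → Bool) → Set
Acyclic E = ∀ x → ¬ Path E x x

initLabel : {n : ℕ} → Fin n → Fin n → Fin n → Label
initLabel s e x with does (x ≟ s) | does (x ≟ e)
... | true  | _     = start
... | false | true  = end
... | false | false = internal

mkGraph : (n : ℕ) → (Fin n → Fin n → Bool) → Fin n → Fin n → Graph
mkGraph n E s e = record { size = n ; edge = E ; label = initLabel s e }

{-# OPTIONS --safe #-}
module Submission where

-- Weigh every node x of the DAG by the number f x of directed paths starting
-- at x (the trivial one included).  Then every node weighs at least 1, any set
-- of children of x weighs at most f x, and any set of nodes at most the total
-- weight M.  These properties survive every step of SimplifyDAG.  A merge of u
-- and v gives the new node the weight of v (extend) or of u (join), so the total
-- drops by at least f v ≥ 1.  A split of u gives u₁ the weight of c₁ and u₂ the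
-- rest f u ∸ f c₁, which is positive because u has a second child; the total is
-- kept and one node is added.  Since a graph of total weight M has at most M
-- nodes, the pair (M , M ∸ #nodes) decreases lexicographically at every step.

open import Data.Bool using (Bool; true; false)
import Data.Bool as Bool
open import Data.Fin using (Fin; zero; suc; toℕ; _≟_)
open import Data.Fin.Properties using (pigeonhole; injective⇒≤; toℕ<n)
open import Data.List using (List; []; _∷_; _++_; [_]; map; length; filter; allFin; partitionSums)
open import Data.List.Properties using (map-cong; map-∘; length-tabulate)
open import Data.List.Membership.Propositional using (_∈_)
open import Data.List.Membership.Propositional.Properties using (∈-∃++; ∈-allFin; ∈-filter⁺; ∈-filter⁻)
open import Data.List.Relation.Binary.Subset.Propositional using (_⊆_)
open import Data.List.Relation.Binary.Permutation.Propositional using (↭-sym)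
open import Data.List.Relation.Binary.Permutation.Propositional.Properties using (shift; ∈-resp-↭)
import Data.List.Relation.Binary.Permutation.Propositional.Properties as Perm
open import Data.List.Relation.Unary.All using (All; []; _∷_)
import Data.List.Relation.Unary.All as All
import Data.List.Relation.Unary.All.Properties as All
open import Data.List.Relation.Unary.Any using (here; there)
open import Data.List.Relation.Unary.AllPairs using ([]; _∷_)
open import Data.List.Relation.Unary.Unique.Propositional using (Unique)
import Data.List.Relation.Unary.Unique.Propositional.Properties as Unique
open import Data.Nat using (ℕ; zero; suc; _+_; _∸_; _≤_; _<_; z≤n; s≤s; s≤s⁻¹)
open import Data.Nat.Induction using (<-wellFounded)
open import Data.Nat.ListAction using (sum)
open import Data.Nat.ListAction.Properties using (sum-↭)
open import Data.Nat.Properties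
  using (+-assoc; +-comm; +-identityʳ; +-monoˡ-≤; +-monoʳ-≤; +-mono-≤; ≤-refl; ≤-reflexive;
         ≤-trans; <⇒≤; n<1+n; m<m+n; m≤m+n; m≤n⇒m<n∨m≡n; m<n⇒0<n∸m; m+[n∸m]≡n; m+n≤o⇒m≤o∸n;
         ∸-monoʳ-≤; ∸-monoʳ-<;
         +-commutativeSemigroup; module ≤-Reasoning)
open import Algebra.Properties.CommutativeSemigroup +-commutativeSemigroup using (interchange; x∙yz≈y∙xz)
open import Data.Product using (Σ; _×_; _,_; proj₁; proj₂; ∃)
open import Data.Product.Relation.Binary.Lex.Strict using (×-Lex; ×-wellFounded)
open import Data.Sum using (_⊎_; inj₁; inj₂; [_,_]′)
open import Data.Unit using (⊤)
open import Function using (_∘_; id; const)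
open import Function.Bundles using (_↔_; Inverse; Injection)
open import Function.Definitions using (Injective)
open import Function.Properties.Inverse using (↔⇒↣; ↔-sym)
open import Induction.WellFounded using (Acc; acc)
open import Relation.Nullary using (¬_; yes; no; contradiction)
open import Relation.Binary.PropositionalEquality
  using (_≡_; _≢_; refl; sym; trans; cong; cong₂; subst; subst₂; module ≡-Reasoning)

open import Defs

module _ {A : Set} where

  sum-map-+ : ∀ (g h : A → ℕ) xs →
              sum (map (λ x → g x + h x) xs) ≡ sum (map g xs) + sum (map h xs)
  sum-map-+ g h [] = refl
  sum-map-+ g h (x ∷ xs) = begin
    g x + h x + sum (map (λ x → g x + h x) xs)     ≡⟨ cong (g x + h x +_) (sum-map-+ g h xs) ⟩
    g x + h x + (sum (map g xs) + sum (map h xs))  ≡⟨ interchange (g x) (h x) _ _ ⟩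
    g x + sum (map g xs) + (h x + sum (map h xs))  ∎
    where open ≡-Reasoning

  sum-map-zero : ∀ {g : A → ℕ} {xs} → All (λ x → g x ≡ 0) xs → sum (map g xs) ≡ 0
  sum-map-zero [] = refl
  sum-map-zero (gx≡0 ∷ gxs≡0) = cong₂ _+_ gx≡0 (sum-map-zero gxs≡0)

  sum-map-mono : ∀ {g h : A → ℕ} → (∀ x → g x ≤ h x) → ∀ xs → sum (map g xs) ≤ sum (map h xs)
  sum-map-mono g≤h [] = z≤n
  sum-map-mono g≤h (x ∷ xs) = +-mono-≤ (g≤h x) (sum-map-mono g≤h xs)

  length≤sum-map : ∀ {g : A → ℕ} → (∀ x → 0 < g x) → ∀ xs → length xs ≤ sum (map g xs)
  length≤sum-map g>0 [] = z≤n
  length≤sum-map g>0 (x ∷ xs) = +-mono-≤ (g>0 x) (length≤sum-map g>0 xs)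

  sum-map-⊆ : ∀ (g : A → ℕ) {xs ys} → Unique xs → xs ⊆ ys → sum (map g xs) ≤ sum (map g ys)
  sum-map-⊆ g [] _ = z≤n
  sum-map-⊆ g {x ∷ xs} (x∉xs ∷ xs!) x∷xs⊆ys
    with as , bs , refl ← ∈-∃++ (x∷xs⊆ys (here refl)) = begin
    g x + sum (map g xs)             ≤⟨ +-monoʳ-≤ (g x) (sum-map-⊆ g xs! xs⊆as++bs) ⟩
    sum (map g (x ∷ as ++ bs))       ≡⟨ sum-↭ (Perm.map⁺ g (↭-sym (shift x as bs))) ⟩
    sum (map g (as ++ [ x ] ++ bs))  ∎
    where
    open ≤-Reasoning
    xs⊆as++bs : xs ⊆ as ++ bs
    xs⊆as++bs y∈xs with ∈-resp-↭ (shift x as bs) (x∷xs⊆ys (there y∈xs))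
    ... | here y≡x = contradiction (sym y≡x) (All.lookup x∉xs y∈xs)
    ... | there y∈as++bs = y∈as++bs

module _ {A B : Set} where

  lefts : List (A ⊎ B) → List A
  lefts = proj₁ ∘ partitionSums

  rights : List (A ⊎ B) → List B
  rights = proj₂ ∘ partitionSums

  All-lefts : ∀ {P : A ⊎ B → Set} {ks} → All P ks → All (P ∘ inj₁) (lefts ks)
  All-lefts {ks = []} [] = []
  All-lefts {ks = inj₁ a ∷ ks} (p ∷ ps) = p ∷ All-lefts ps
  All-lefts {ks = inj₂ b ∷ ks} (p ∷ ps) = All-lefts ps

  All-rights : ∀ {P : A ⊎ B → Set} {ks} → All P ks → All (P ∘ inj₂) (rights ks)
  All-rights {ks = []} [] = []
  All-rights {ks = inj₁ a ∷ ks} (p ∷ ps) = All-rights ps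
  All-rights {ks = inj₂ b ∷ ks} (p ∷ ps) = p ∷ All-rights ps

  Unique-lefts : ∀ {ks} → Unique ks → Unique (lefts ks)
  Unique-lefts {[]} [] = []
  Unique-lefts {inj₁ a ∷ ks} (a∉ks ∷ ks!) =
    All.map (λ ne eq → ne (cong inj₁ eq)) (All-lefts a∉ks) ∷ Unique-lefts ks!
  Unique-lefts {inj₂ b ∷ ks} (_ ∷ ks!) = Unique-lefts ks!

  Unique-rights : ∀ {ks} → Unique ks → Unique (rights ks)
  Unique-rights {[]} [] = []
  Unique-rights {inj₁ a ∷ ks} (_ ∷ ks!) = Unique-rights ks!
  Unique-rights {inj₂ b ∷ ks} (b∉ks ∷ ks!) =
    All.map (λ ne eq → ne (cong inj₂ eq)) (All-rights b∉ks) ∷ Unique-rights ks!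

  sum-map-partitionSums : ∀ (g : A ⊎ B → ℕ) ks →
    sum (map g ks) ≡ sum (map (g ∘ inj₁) (lefts ks)) + sum (map (g ∘ inj₂) (rights ks))
  sum-map-partitionSums g [] = refl
  sum-map-partitionSums g (inj₁ a ∷ ks) =
    trans (cong (g (inj₁ a) +_) (sum-map-partitionSums g ks)) (sym (+-assoc (g (inj₁ a)) _ _))
  sum-map-partitionSums g (inj₂ b ∷ ks) =
    trans (cong (g (inj₂ b) +_) (sum-map-partitionSums g ks))
          (x∙yz≈y∙xz (g (inj₂ b)) (sum (map (g ∘ inj₁) (lefts ks))) _)

-- Finite sets of nodes are represented by duplicate-free lists.
record Weighting {V : Set} (_⇒_ : V → V → Set) (f : V → ℕ) (M : ℕ) : Set where
  field
    positive  : ∀ x → 0 < f x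
    children≤ : ∀ x {cs} → Unique cs → All (x ⇒_) cs → sum (map f cs) ≤ f x
    total≤    : ∀ {cs} → Unique cs → sum (map f cs) ≤ M
open Weighting

size≤total : ∀ {n} {_⇒_ : Fin n → Fin n → Set} {f M} → Weighting _⇒_ f M → n ≤ M
size≤total {n} {f = f} W = begin
  n                         ≡⟨ length-tabulate (λ i → i) ⟨
  length (allFin n)         ≤⟨ length≤sum-map (positive W) (allFin n) ⟩
  sum (map f (allFin n))    ≤⟨ total≤ W (Unique.allFin⁺ n) ⟩
  _                         ∎
  where open ≤-Reasoning

sum-map-∘-≤ : ∀ {A B : Set} (f : A → ℕ) {φ ψ : B → A} → (∀ y → f (ψ y) ≤ f (φ y)) →
              ∀ ys → sum (map (f ∘ ψ) ys) ≤ sum (map f (map φ ys))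
sum-map-∘-≤ f ψ≤φ ys = ≤-trans (sum-map-mono ψ≤φ ys) (≤-reflexive (cong sum (map-∘ ys)))

weighting-pullback : ∀ {A B : Set} {_⇒_ : A → A → Set} {_⇒′_ : B → B → Set} {f M}
  (φ ψ : B → A) → Injective _≡_ _≡_ φ → (∀ {x y} → x ⇒′ y → ψ x ⇒ φ y) →
  (∀ y → f (ψ y) ≤ f (φ y)) → Weighting _⇒_ f M → Weighting _⇒′_ (f ∘ ψ) M
weighting-pullback {f = f} φ ψ φ-injective edge ψ≤φ W = record
  { positive  = positive W ∘ ψ
  ; children≤ = λ x {ys} ys! x⇒ys → ≤-trans (sum-map-∘-≤ f {φ} ψ≤φ ys)
      (children≤ W (ψ x) (Unique.map⁺ φ-injective ys!) (All.map⁺ (All.map edge x⇒ys)))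
  ; total≤    = λ {ys} ys! → ≤-trans (sum-map-∘-≤ f {φ} ψ≤φ ys)
      (total≤ W (Unique.map⁺ φ-injective ys!))
  }

EdgeVia : ∀ {K : Set} (H : Graph) → K ↔ Fin (size H) → K → K → Set
EdgeVia H iso k l = Edge H (Inverse.to iso k) (Inverse.to iso l)

weighting-along-↔ : ∀ {K : Set} {H : Graph} (iso : K ↔ Fin (size H)) {g : K → ℕ} {M} →
  Weighting (EdgeVia H iso) g M → Weighting (Edge H) (g ∘ Inverse.from iso) M
weighting-along-↔ {H = H} iso = weighting-pullback from from
  (Injection.injective (↔⇒↣ (↔-sym iso)))
  (λ {x} {y} → subst₂ (Edge H) (sym (to∘from x)) (sym (to∘from y)))
  (λ _ → ≤-refl)
  where
  open Inverse iso using (from) renaming (strictlyInverseˡ to to∘from)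

Path-∷ʳ : ∀ {n} {E : Fin n → Fin n → Bool} {x y z} → Path E x y → E y z ≡ true → Path E x z
Path-∷ʳ (one x⇒y) y⇒z = more x⇒y (one y⇒z)
Path-∷ʳ (more x⇒w w⇝y) y⇒z = more x⇒w (Path-∷ʳ w⇝y y⇒z)

module PathCount {n : ℕ} (E : Fin n → Fin n → Bool) where

  children : Fin n → List (Fin n)
  children x = filter (λ c → E x c Bool.≟ true) (allFin n)

  ∈-children⁺ : ∀ {x c} → E x c ≡ true → c ∈ children x
  ∈-children⁺ {x} = ∈-filter⁺ (λ c → E x c Bool.≟ true) (∈-allFin _)

  ∈-children⁻ : ∀ {x c} → c ∈ children x → E x c ≡ true
  ∈-children⁻ {x} = proj₂ ∘ ∈-filter⁻ (λ c → E x c Bool.≟ true) {xs = allFin n}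

  walks : ℕ → Fin n → ℕ
  walks zero x = 1
  walks (suc k) x = sum (map (walks k) (children x))

  paths : ℕ → Fin n → ℕ
  paths zero x = 0
  paths (suc k) x = suc (sum (map (paths k) (children x)))

  paths-suc : ∀ k x → paths (suc k) x ≡ paths k x + walks k x
  paths-suc zero x = cong suc (sum-map-zero (All.universal (λ _ → refl) (children x)))
  paths-suc (suc k) x = cong suc (begin
    sum (map (paths (suc k)) (children x))
      ≡⟨ cong sum (map-cong (paths-suc k) (children x)) ⟩
    sum (map (λ c → paths k c + walks k c) (children x))
      ≡⟨ sum-map-+ (paths k) (walks k) (children x) ⟩
    sum (map (paths k) (children x)) + sum (map (walks k) (children x))
      ∎)
    where open ≡-Reasoning

  Walk : ℕ → Fin n → Set
  Walk k x = Σ (ℕ → Fin n) λ g → g 0 ≡ x × (∀ i → i < k → E (g i) (g (suc i)) ≡ true)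

  walk-∷ : ∀ {k x c} → E x c ≡ true → Walk k c → Walk (suc k) x
  walk-∷ {k} {x} x⇒c (g , refl , steps) = g′ , refl , steps′
    where
    g′ : ℕ → Fin n
    g′ zero = x
    g′ (suc i) = g i
    steps′ : ∀ i → i < suc k → E (g′ i) (g′ (suc i)) ≡ true
    steps′ zero _ = x⇒c
    steps′ (suc i) i<k = steps i (s≤s⁻¹ i<k)

  walks-zero : ∀ k x → ¬ Walk k x → walks k x ≡ 0
  walks-zero zero x no-walk = contradiction ((λ _ → x) , refl , λ _ ()) no-walk
  walks-zero (suc k) x no-walk = sum-map-zero {xs = children x}
    (All.tabulate λ c∈children → walks-zero k _ (no-walk ∘ walk-∷ (∈-children⁻ c∈children)))

  walk-path : ∀ {k} (g : ℕ → Fin n) → (∀ i → i < k → E (g i) (g (suc i)) ≡ true) →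
              ∀ {i j} → i < j → j ≤ k → Path E (g i) (g j)
  walk-path g steps {i} {suc j} i<1+j 1+j≤k with m≤n⇒m<n∨m≡n (s≤s⁻¹ i<1+j)
  ... | inj₁ i<j = Path-∷ʳ (walk-path g steps i<j (<⇒≤ 1+j≤k)) (steps j 1+j≤k)
  ... | inj₂ refl = one (steps i 1+j≤k)

  module _ (acyclic : Acyclic E) where

    -- A walk visiting n + 1 nodes repeats one of them, closing a cycle.
    no-walk-of-length-n : ∀ x → ¬ Walk n x
    no-walk-of-length-n x (g , _ , steps) with pigeonhole (n<1+n n) (g ∘ toℕ)
    ... | i , j , i<j , gi≡gj = acyclic (g (toℕ j))
      (subst (λ y → Path E y (g (toℕ j))) gi≡gj (walk-path g steps i<j (s≤s⁻¹ (toℕ<n j))))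

    paths-stable : ∀ x → paths (suc n) x ≡ paths n x
    paths-stable x = begin
      paths (suc n) x          ≡⟨ paths-suc n x ⟩
      paths n x + walks n x    ≡⟨ cong (paths n x +_) (walks-zero n x (no-walk-of-length-n x)) ⟩
      paths n x + 0            ≡⟨ +-identityʳ (paths n x) ⟩
      paths n x                ∎
      where open ≡-Reasoning

    path-weighting : Weighting (λ x y → E x y ≡ true) (paths (suc n)) (sum (map (paths (suc n)) (allFin n)))
    path-weighting = record
      { positive  = λ _ → s≤s z≤n
      ; children≤ = λ x {cs} cs! x⇒cs → begin
          sum (map (paths (suc n)) cs)
            ≤⟨ sum-map-⊆ (paths (suc n)) cs! (∈-children⁺ ∘ All.lookup x⇒cs) ⟩
          sum (map (paths (suc n)) (children x)) ≡⟨ cong sum (map-cong paths-stable (children x)) ⟩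
          sum (map (paths n) (children x))       <⟨ n<1+n _ ⟩
          paths (suc n) x                        ∎
      ; total≤    = λ cs! → sum-map-⊆ (paths (suc n)) cs! (λ _ → ∈-allFin _)
      }
      where open ≤-Reasoning

module Merge {G H : Graph} {u v : Fin (size G)} (mr : MergeResult G u v H) (u≢v : u ≢ v) where
  open MergeResult mr

  origin : Kept₂ G u v ⊎ ⊤ → Fin (size G)
  origin = [ proj₁ , const u ]′

  -- refl suffices: all proofs of x ≢ u are judgementally equal, as ⊥ is irrelevant.
  origin-injective : Injective _≡_ _≡_ origin
  origin-injective {inj₁ (x , _)} {inj₁ (.x , _)} refl = refl
  origin-injective {inj₁ (x , x≢u , _)} {inj₂ _} x≡u = contradiction x≡u x≢u
  origin-injective {inj₂ _} {inj₁ (x , x≢u , _)} u≡x = contradiction (sym u≡x) x≢u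
  origin-injective {inj₂ _} {inj₂ _} _ = refl

  v≢origin : ∀ k → v ≢ origin k
  v≢origin (inj₁ (x , _ , x≢v)) v≡x = x≢v (sym v≡x)
  v≢origin (inj₂ _) v≡u = u≢v (sym v≡u)

  -- The merged node is weighed as p but traced back to u; p is v for TryExtend
  -- and u for TryJoin.
  module _ {p : Fin (size G)} (children-v⊆p : ∀ {c} → Edge G v c → Edge G p c) where

    proxy : Kept₂ G u v ⊎ ⊤ → Fin (size G)
    proxy = [ proj₁ , const p ]′

    edge-proxy : ∀ {k l} → EdgeVia H iso k l → Edge G (proxy k) (origin l)
    edge-proxy {inj₁ a} {inj₁ b} e = trans (sym (edge-old a b)) e
    edge-proxy {inj₁ a} {inj₂ _} e = trans (sym (edge-in a)) e
    edge-proxy {inj₂ _} {inj₁ b} e = children-v⊆p (trans (sym (edge-out b)) e)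
    edge-proxy {inj₂ _} {inj₂ _} e = contradiction (trans (sym edge-ww) e) λ ()

    merge-weighting : ∀ {f M} → f p ≤ f u → Weighting (Edge G) f M →
                      Weighting (Edge H) (f ∘ proxy ∘ Inverse.from iso) (M ∸ 1)
    merge-weighting {f} {M} fp≤fu W = weighting-along-↔ {H = H} iso record
      { positive  = positive pulled
      ; children≤ = children≤ pulled
      ; total≤    = total≤-drop
      }
      where
      proxy≤origin : ∀ k → f (proxy k) ≤ f (origin k)
      proxy≤origin (inj₁ _) = ≤-refl
      proxy≤origin (inj₂ _) = fp≤fu

      pulled : Weighting (EdgeVia H iso) (f ∘ proxy) M
      pulled = weighting-pullback origin proxy origin-injective edge-proxy proxy≤origin W

      total≤-drop : ∀ {ks} → Unique ks → sum (map (f ∘ proxy) ks) ≤ M ∸ 1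
      total≤-drop {ks} ks! = begin
        sum (map (f ∘ proxy) ks)  ≤⟨ m+n≤o⇒m≤o∸n _ (begin
          sum (map (f ∘ proxy) ks) + f v     ≤⟨ +-monoˡ-≤ (f v) (sum-map-∘-≤ f proxy≤origin ks) ⟩
          sum (map f (map origin ks)) + f v  ≡⟨ +-comm _ (f v) ⟩
          sum (map f (v ∷ map origin ks))    ≤⟨ total≤ W (All.map⁺ (All.universal v≢origin ks)
                                                          ∷ Unique.map⁺ origin-injective ks!) ⟩
          M                                  ∎) ⟩
        M ∸ f v                   ≤⟨ ∸-monoʳ-≤ M (positive W v) ⟩
        M ∸ 1                     ∎
        where open ≤-Reasoning

module Split {G H : Graph} {u : Fin (size G)} {c₁ : Kept₁ G u} (sr : SplitResult G u c₁ H) where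
  open SplitResult sr

  child₁ : Fin (size G)
  child₁ = proj₁ c₁

  keep : Fin (size G) → Kept₁ G u ⊎ Bool
  keep x with x ≟ u
  ... | yes _   = inj₂ true
  ... | no x≢u = inj₁ (x , x≢u)

  keep-injective : Injective _≡_ _≡_ keep
  keep-injective {x} {y} eq with x ≟ u | y ≟ u | eq
  ... | yes x≡u | yes y≡u | _    = trans x≡u (sym y≡u)
  ... | no _    | no _    | refl = refl

  keep≢new-false : ∀ x → keep x ≢ inj₂ false
  keep≢new-false x eq with x ≟ u | eq
  ... | yes _ | ()
  ... | no _  | ()

  widen : Fin (suc (size G)) → Kept₁ G u ⊎ Bool
  widen zero    = inj₂ false
  widen (suc x) = keep x

  widen-injective : Injective _≡_ _≡_ widen
  widen-injective {zero}  {zero}  _  = refl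
  widen-injective {zero}  {suc y} eq = contradiction (sym eq) (keep≢new-false y)
  widen-injective {suc x} {zero}  eq = contradiction eq (keep≢new-false x)
  widen-injective {suc x} {suc y} eq = cong suc (keep-injective eq)

  size< : size G < size H
  size< = injective⇒≤ {f = Inverse.to iso ∘ widen} (widen-injective ∘ Injection.injective (↔⇒↣ iso))

  Kept₁-proj₁-injective : ∀ {a b : Kept₁ G u} → proj₁ a ≡ proj₁ b → a ≡ b
  Kept₁-proj₁-injective {_ , _} {_ , _} refl = refl

  olds : List (Kept₁ G u ⊎ Bool) → List (Fin (size G))
  olds ks = map proj₁ (lefts ks)

  olds-unique : ∀ {ks} → Unique ks → Unique (olds ks)
  olds-unique ks! = Unique.map⁺ Kept₁-proj₁-injective (Unique-lefts ks!)

  u∷olds-unique : ∀ {ks} → Unique ks → Unique (u ∷ olds ks)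
  u∷olds-unique {ks} ks! = All.map⁺ (All.universal (λ a → proj₂ a ∘ sym) (lefts ks)) ∷ olds-unique ks!

  child-of-new-false : ∀ {a} → EdgeVia H iso (inj₂ false) (inj₁ a) → proj₁ a ≡ child₁
  child-of-new-false {a} e with proj₁ a ≟ child₁ | trans (sym (edge-out₁ a)) e
  ... | yes a≡c₁ | _ = a≡c₁
  ... | no _     | ()

  child-of-new-true : ∀ {a} → EdgeVia H iso (inj₂ true) (inj₁ a) →
                      Edge G u (proj₁ a) × proj₁ a ≢ child₁
  child-of-new-true {a} e with edge G u (proj₁ a) | proj₁ a ≟ child₁ | trans (sym (edge-out₂ a)) e
  ... | true  | no a≢c₁ | _  = refl , a≢c₁
  ... | true  | yes _   | ()
  ... | false | _       | ()

  children-of-old : ∀ {a ks} → All (EdgeVia H iso (inj₁ a)) ks → All (Edge G (proj₁ a)) (olds ks)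
  children-of-old {a} a⇒ks = All.map⁺ (All.map (λ {b} e → trans (sym (edge-old a b)) e) (All-lefts a⇒ks))

  no-new-children : ∀ {i bs} → All (EdgeVia H iso (inj₂ i) ∘ inj₂) bs → bs ≡ []
  no-new-children [] = refl
  no-new-children {i} (i⇒b ∷ _) = contradiction (trans (sym (edge-new i _)) i⇒b) λ ()

  module _ {f M} (W : Weighting (Edge G) f M) {d} (d≢c₁ : d ≢ child₁) (u⇒d : Edge G u d)
           (u⇒c₁ : Edge G u child₁) where

    newWeight : Bool → ℕ
    newWeight false = f child₁
    newWeight true  = f u ∸ f child₁

    splitWeight : Kept₁ G u ⊎ Bool → ℕ
    splitWeight = [ f ∘ proj₁ , newWeight ]′

    child₁<u : f child₁ < f u
    child₁<u = begin-strict
      f child₁               <⟨ m<m+n (f child₁) (≤-trans (positive W d) (m≤m+n (f d) 0)) ⟩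
      f child₁ + (f d + 0)   ≤⟨ children≤ W u ((d≢c₁ ∘ sym ∷ []) ∷ [] ∷ []) (u⇒c₁ ∷ u⇒d ∷ []) ⟩
      f u                    ∎
      where open ≤-Reasoning

    sum-newWeight≤ : ∀ {bs} → Unique bs → sum (map newWeight bs) ≤ f u
    sum-newWeight≤ {bs} bs! = begin
      sum (map newWeight bs)             ≤⟨ sum-map-⊆ newWeight bs! every-bool ⟩
      f child₁ + ((f u ∸ f child₁) + 0)  ≡⟨ cong (f child₁ +_) (+-identityʳ _) ⟩
      f child₁ + (f u ∸ f child₁)        ≡⟨ m+[n∸m]≡n (<⇒≤ child₁<u) ⟩
      f u                                ∎
      where
      open ≤-Reasoning
      every-bool : ∀ {bs} → bs ⊆ false ∷ true ∷ []
      every-bool {x = false} _ = here refl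
      every-bool {x = true}  _ = there (here refl)

    sum-splitWeight : ∀ ks → sum (map splitWeight ks) ≡ sum (map f (olds ks)) + sum (map newWeight (rights ks))
    sum-splitWeight ks = trans (sum-map-partitionSums splitWeight ks)
      (cong (_+ sum (map newWeight (rights ks))) (cong sum (map-∘ (lefts ks))))

    sum-splitWeight≤ : ∀ {ks} → Unique ks → sum (map splitWeight ks) ≤ sum (map f (u ∷ olds ks))
    sum-splitWeight≤ {ks} ks! = begin
      sum (map splitWeight ks)                                             ≡⟨ sum-splitWeight ks ⟩
      sum (map f (olds ks)) + sum (map newWeight (rights ks))
        ≤⟨ +-monoʳ-≤ _ (sum-newWeight≤ (Unique-rights ks!)) ⟩
      sum (map f (olds ks)) + f u                                      ≡⟨ +-comm _ (f u) ⟩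
      sum (map f (u ∷ olds ks))                                        ∎
      where open ≤-Reasoning

    sum-splitWeight-olds : ∀ {i ks} → All (EdgeVia H iso (inj₂ i)) ks →
                           sum (map splitWeight ks) ≡ sum (map f (olds ks))
    sum-splitWeight-olds {ks = ks} i⇒ks = begin
      sum (map splitWeight ks)                                     ≡⟨ sum-splitWeight ks ⟩
      sum (map f (olds ks)) + sum (map newWeight (rights ks))
        ≡⟨ cong (λ bs → sum (map f (olds ks)) + sum (map newWeight bs)) (no-new-children (All-rights i⇒ks)) ⟩
      sum (map f (olds ks)) + 0                                ≡⟨ +-identityʳ _ ⟩
      sum (map f (olds ks))                                    ∎
      where open ≡-Reasoning

    splitWeight-children≤ : ∀ k {ks} → Unique ks → All (EdgeVia H iso k) ks →
                            sum (map splitWeight ks) ≤ splitWeight k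
    splitWeight-children≤ (inj₁ a) {ks} ks! a⇒ks with rights ks | All-rights a⇒ks | sum-splitWeight ks
    ... | []    | []        | sum≡ = ≤-trans (≤-reflexive (trans sum≡ (+-identityʳ _)))
                                       (children≤ W (proj₁ a) (olds-unique ks!) (children-of-old a⇒ks))
    ... | b ∷ _ | a⇒b ∷ _   | _    = ≤-trans (sum-splitWeight≤ ks!)
                                       (children≤ W (proj₁ a) (u∷olds-unique ks!)
                                         (trans (sym (edge-in a b)) a⇒b ∷ children-of-old a⇒ks))
    splitWeight-children≤ (inj₂ false) {ks} ks! ⇒ks = begin
      sum (map splitWeight ks)       ≡⟨ sum-splitWeight-olds ⇒ks ⟩
      sum (map f (olds ks))      ≤⟨ sum-map-⊆ f {ys = [ child₁ ]} (olds-unique ks!)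
                                      (here ∘ All.lookup olds≡c₁) ⟩
      f child₁ + 0               ≡⟨ +-identityʳ _ ⟩
      f child₁                   ∎
      where
      open ≤-Reasoning
      olds≡c₁ : All (_≡ child₁) (olds ks)
      olds≡c₁ = All.map⁺ (All.map child-of-new-false (All-lefts ⇒ks))
    splitWeight-children≤ (inj₂ true) {ks} ks! ⇒ks = begin
      sum (map splitWeight ks)       ≡⟨ sum-splitWeight-olds ⇒ks ⟩
      sum (map f (olds ks))      ≤⟨ m+n≤o⇒m≤o∸n _ (≤-trans (≤-reflexive (+-comm _ (f child₁)))
                                      (children≤ W u (c₁∉olds ∷ olds-unique ks!)
                                        (u⇒c₁ ∷ All.map proj₁ olds-info))) ⟩
      f u ∸ f child₁             ∎
      where
      open ≤-Reasoning
      olds-info : All (λ x → Edge G u x × x ≢ child₁) (olds ks)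
      olds-info = All.map⁺ (All.map child-of-new-true (All-lefts ⇒ks))
      c₁∉olds : All (child₁ ≢_) (olds ks)
      c₁∉olds = All.map (λ (_ , x≢c₁) → x≢c₁ ∘ sym) olds-info

    split-weighting : Weighting (Edge H) (splitWeight ∘ Inverse.from iso) M
    split-weighting = weighting-along-↔ {H = H} iso record
      { positive  = λ where
          (inj₁ a)     → positive W (proj₁ a)
          (inj₂ false) → positive W child₁
          (inj₂ true)  → m<n⇒0<n∸m child₁<u
      ; children≤ = splitWeight-children≤
      ; total≤    = λ ks! → ≤-trans (sum-splitWeight≤ ks!) (total≤ W (u∷olds-unique ks!))
      }

other-than : ∀ {n} {P : Fin n → Set} {x y} (z : Fin n) → x ≢ y → P x → P y → ∃ λ w → w ≢ z × P w
other-than {x = x} z x≢y Px Py with x ≟ z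
... | yes refl = _ , x≢y ∘ sym , Py
... | no x≢z   = x , x≢z , Px

_⊏_ : ℕ × ℕ → ℕ × ℕ → Set
_⊏_ = ×-Lex _≡_ _<_ _<_

terminates : ∀ {G f M} → Weighting (Edge G) f M → Acc _⊏_ (M , M ∸ size G) → Terminates G
terminates {G} {f} {M} W (acc smaller) = acc next
  where
  M∸1<M : 3 < size G → M ∸ 1 < M
  M∸1<M 3<n = ∸-monoʳ-< (s≤s z≤n) (≤-trans (s≤s z≤n) (≤-trans 3<n (size≤total W)))

  next : ∀ {H} → Step G H → Terminates H
  next (extend 3<n u v (u⇒v , u≢v , _) mr) =
    terminates (Merge.merge-weighting mr u≢v id fv≤fu W) (smaller (inj₁ (M∸1<M 3<n)))
    where
    fv≤fu : f v ≤ f u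
    fv≤fu = ≤-trans (m≤m+n (f v) 0) (children≤ W u ([] ∷ []) (u⇒v ∷ []))
  next (join 3<n _ u v (u≢v , _ , _ , _ , same-children) mr) =
    terminates (Merge.merge-weighting mr u≢v (λ {c} → trans (same-children c)) ≤-refl W)
               (smaller (inj₁ (M∸1<M 3<n)))
  next (split _ _ _ u (_ , c , c′ , c≢c′ , u⇒c , u⇒c′) c₁ u⇒c₁ sr)
    with other-than (proj₁ c₁) c≢c′ u⇒c u⇒c′
  ... | d , d≢c₁ , u⇒d =
    terminates W′ (smaller (inj₂ (refl , ∸-monoʳ-< (Split.size< sr) (size≤total W′))))
    where W′ = Split.split-weighting sr W d≢c₁ u⇒d u⇒c₁

mainTheorem10 : (n : ℕ) (E : Fin n → Fin n → Bool) (s e : Fin n) →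
    s ≢ e → Acyclic E → Terminates (mkGraph n E s e)
mainTheorem10 n E s e _ acyclic =
  terminates (path-weighting acyclic) (×-wellFounded <-wellFounded <-wellFounded _)
  where open PathCount E
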